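{- Let $a=(a_n)_{n\in\mathbb{N}}$ and $b=(b_n)_{n\in\mathbb{N}}$ be sequences of positive integers, set $a_0=b_0=0$, and suppose $\{(a_n,b_n)\mid n\in\mathbb{N}_0\}$ is $b_1$-SAC. Then: (i) for all $n\in\mathbb{N}_0$, $b_{n+1}-b_n\ge b_1\ge 2$; (ii) for all $n\in\mathbb{N}_0$, $a_{n+1}-a_n\in\{1,2\}$; (iii) $a_n<b_n$ for all $n\in\mathbb{N}$, and the sequence $(b_n-a_n)_{n\in\mathbb{N}_0}$ is non-decreasing; (iv) for all $m,n\in\mathbb{N}_0$, $a_m+a_n-1\le a_{m+n}\le a_m+a_n+1$.
   Context: $\mathbb{N}$ denotes the positive integers, $\mathbb{N}_0$ the non-negative integers. Sequences $(x_n)_{n\in\mathbb{N}}$, $(y_n)_{n\in\mathbb{N}}$ of positive integers are complementary if $\{x_n\}\cup\{y_n\}=\mathbb{N}$ and $\{x_n\}\cap\{y_n\}=\emptyset$. For $t\in\mathbb{N}$, $(X_n)_{n\in\mathbb{N}_0}$ is $t$-superadditive if $X_m+X_n\le X_{m+n}<X_m+X_n+t$ for all $m,n\in\mathbb{N}_0$. With $a_0=b_0=0$, the set $\{(a_n,b_n)\mid n\in\mathbb{N}_0\}$ is $t$-SAC if: $a_1=1$; $(a_n)_{n\in\mathbb{N}}$ and $(b_n)_{n\in\mathbb{N}}$ are complementary; $a$ is increasing; and $(b_n)_{n\in\mathbb{N}_0}$ is $t$-superadditive. -}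

module Defs where

open import Data.Nat using (ℕ; zero; suc; _+_; _≤_; _<_)
open import Data.Product using (_×_; ∃-syntax)
open import Data.Sum using (_⊎_)
open import Relation.Binary.PropositionalEquality using (_≡_)
open import Relation.Nullary using (¬_)

-- Sequences are functions ℕ → ℕ, index 0 included (a 0 = b 0 = 0 imposed separately).

Complementary : (ℕ → ℕ) → (ℕ → ℕ) → Set
Complementary x y =
  (∀ k → 1 ≤ k → (∃[ n ] (1 ≤ n × x n ≡ k)) ⊎ (∃[ n ] (1 ≤ n × y n ≡ k)))
  × (∀ m n → 1 ≤ m → 1 ≤ n → ¬ (x m ≡ y n))

Superadditive : ℕ → (ℕ → ℕ) → Set
Superadditive t X = ∀ m n → (X m + X n ≤ X (m + n)) × (X (m + n) < X m + X n + t)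

Increasing : (ℕ → ℕ) → Set
Increasing a = ∀ m n → 1 ≤ m → m < n → a m < a n

SAC : ℕ → (ℕ → ℕ) → (ℕ → ℕ) → Set
SAC t a b = (a 1 ≡ 1) × Complementary a b × Increasing a × Superadditive t b

-- Superadditivity with t = b₁ gives b (n+1) ≥ b n + b₁, and b₁ ≥ 2
-- because b₁ ≠ a₁ = 1; so b is strictly increasing with gaps of size at
-- least 2.  Since a is increasing and a, b are complementary, a enumerates
-- exactly the integers that are not values of b.  Hence, if p is the number
-- of positive b-values below a i, then a i = i + p and
--   b p ≤ i + p < b (p+1)                                       (the invariant)
-- Walking from i to i+1 either stays inside the gap (a i+1 = a i + 1) or
-- jumps over the single b-value b (p+1) = a i + 1 (a i+1 = a i + 2); this
-- gives (ii); (i) is superadditivity at (1, n) and (iii) is a short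
-- induction comparing the steps of a and b.  For (iv) write
-- a m = m + p, a n = n + q, a (m+n) = (m+n) + r; superadditivity of b and the
-- invariant force p + q - 1 ≤ r ≤ p + q + 1.
module Submission where

open import Defs
open import Data.Nat using (ℕ; suc; _+_; _∸_; _≤_; _<_)
open import Data.Product using (_×_)
open import Data.Sum using (_⊎_)
open import Relation.Binary.PropositionalEquality using (_≡_)

open import Data.Nat using (zero; z≤n; s≤s; _≤?_)
open import Data.Nat.Properties
open import Algebra.Properties.CommutativeSemigroup +-commutativeSemigroup using (interchange)
open import Data.Product using (_,_; proj₁; proj₂; ∃-syntax)
open import Data.Sum using (inj₁; inj₂)
open import Data.Empty using (⊥-elim)
open import Relation.Nullary using (yes; no)
open import Relation.Binary.PropositionalEquality using (_≢_; refl; sym; trans; cong; cong₂; subst)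
open import Function using (_∘_)
open import Data.Nat.Tactic.RingSolver using (solve-∀)

regroup-suc : ∀ m n p q → m + n + suc (suc (p + q)) ≡ suc (m + p) + suc (n + q)
regroup-suc = solve-∀

StrictlyIncreasing : (ℕ → ℕ) → Set
StrictlyIncreasing f = ∀ n → f n < f (suc n)

module _ {f : ℕ → ℕ} (f-inc : StrictlyIncreasing f) where

  growth : ∀ x k → f x + k ≤ f (x + k)
  growth x zero rewrite +-identityʳ (f x) | +-identityʳ x = ≤-refl
  growth x (suc k) = begin
    f x + suc k        ≡⟨ +-suc (f x) k ⟩
    suc (f x + k)      ≤⟨ s≤s (growth x k) ⟩
    suc (f (x + k))    ≤⟨ f-inc (x + k) ⟩
    f (suc (x + k))    ≡⟨ cong f (sym (+-suc x k)) ⟩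
    f (x + suc k)      ∎
    where open ≤-Reasoning

  lift : ∀ {c s r} → c + s ≤ f s → s ≤ r → c + r ≤ f r
  lift {c} {s} c+s≤fs s≤r with m≤n⇒∃[o]m+o≡n s≤r
  ... | k , refl = begin
    c + (s + k)   ≡⟨ sym (+-assoc c s k) ⟩
    c + s + k     ≤⟨ +-monoˡ-≤ k c+s≤fs ⟩
    f s + k       ≤⟨ growth s k ⟩
    f (s + k)     ∎
    where open ≤-Reasoning

  monotone : ∀ {j k} → j ≤ k → f j ≤ f k
  monotone {j} j≤k with m≤n⇒∃[o]m+o≡n j≤k
  ... | d , refl = ≤-trans (m≤m+n (f j) d) (growth j d)

  gap : ∀ {p v} → f p < v → v < f (suc p) → ∀ j → f j ≢ v
  gap {p} fp<v v<fp+1 j refl with j ≤? p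
  ... | yes j≤p = <⇒≱ fp<v (monotone j≤p)
  ... | no j≰p  = <⇒≱ v<fp+1 (monotone (≰⇒> j≰p))

module SACPair (a b : ℕ → ℕ) (a0 : a 0 ≡ 0) (b0 : b 0 ≡ 0) (b1-pos : 1 ≤ b 1)
               (sac : SAC (b 1) a b) where

  a1 : a 1 ≡ 1
  a1 = proj₁ sac

  covering : ∀ k → 1 ≤ k → (∃[ n ] (1 ≤ n × a n ≡ k)) ⊎ (∃[ n ] (1 ≤ n × b n ≡ k))
  covering = proj₁ (proj₁ (proj₂ sac))

  disjoint : ∀ m n → 1 ≤ m → 1 ≤ n → a m ≢ b n
  disjoint = proj₂ (proj₁ (proj₂ sac))

  superadditive : Superadditive (b 1) b
  superadditive = proj₂ (proj₂ (proj₂ sac))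

  -- b₁ ≠ a₁ = 1, so b₁ ≥ 2.
  b1≥2 : 2 ≤ b 1
  b1≥2 = ≤∧≢⇒< b1-pos (λ 1≡b1 → disjoint 1 1 (s≤s z≤n) (s≤s z≤n) (trans a1 1≡b1))

  b-step : ∀ n → b n + b 1 ≤ b (suc n)
  b-step n = subst (_≤ b (suc n)) (+-comm (b 1) (b n)) (proj₁ (superadditive 1 n))

  b-step2 : ∀ n → 2 + b n ≤ b (suc n)
  b-step2 n = ≤-trans (≤-reflexive (+-comm 2 (b n))) (≤-trans (+-monoʳ-≤ (b n) b1≥2) (b-step n))

  b-inc : StrictlyIncreasing b
  b-inc n = ≤-trans (n≤1+n _) (b-step2 n)

  a-inc : StrictlyIncreasing a
  a-inc zero rewrite a0 | a1 = s≤s z≤n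
  a-inc (suc i) = proj₁ (proj₂ (proj₂ sac)) (suc i) (suc (suc i)) (s≤s z≤n) ≤-refl

  b-super : ∀ p q → b (suc p) + b (suc q) ≤ b (suc (suc (p + q)))
  b-super p q = subst (λ x → b (suc p) + b (suc q) ≤ b (suc x)) (+-suc p q)
                      (proj₁ (superadditive (suc p) (suc q)))

  b-sub : ∀ p q → b (p + q) < b p + b (suc q)
  b-sub p q = ≤-trans (proj₂ (superadditive p q))
                (≤-trans (≤-reflexive (+-assoc (b p) (b q) (b 1))) (+-monoʳ-≤ (b p) (b-step q)))

  skipped-by-a : ∀ i v → a i < v → v < a (suc i) → ∃[ j ] b j ≡ v
  skipped-by-a i v ai<v v<ai+1 with covering v (≤-trans (s≤s z≤n) ai<v)
  ... | inj₁ (j , _ , aj≡v) = ⊥-elim (gap a-inc ai<v v<ai+1 j aj≡v)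
  ... | inj₂ (j , _ , bj≡v) = j , bj≡v

  next-a : ∀ i v → a i < v → (∀ j → b j ≢ v) → a (suc i) ≤ v
  next-a i v ai<v v∉b = ≮⇒≥ λ v<ai+1 →
    let (j , bj≡v) = skipped-by-a i v ai<v v<ai+1 in v∉b j bj≡v

  record Inv (i p : ℕ) : Set where
    field
      val   : a i ≡ i + p
      above : 1 ≤ p → b p < i + p
      below : i + p < b (suc p)

  inv-lo : ∀ {i p} → Inv i p → b p ≤ i + p
  inv-lo {p = zero}  _ = subst (_≤ _) (sym b0) z≤n
  inv-lo {p = suc _} I = <⇒≤ (Inv.above I (s≤s z≤n))

  inv-start : Inv 0 0
  inv-start = record { val = a0 ; above = λ () ; below = b1-pos }

  inv-at : ∀ {i p x} → x ≡ i + p → a i ≡ x → (1 ≤ p → b p < x) → x < b (suc p) → Inv i p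
  inv-at refl ai≡x above below = record { val = ai≡x ; above = above ; below = below }

  stay : ∀ i → (∀ j → b j ≢ suc (a i)) → a (suc i) ≡ suc (a i)
  stay i ai+1∉b = ≤-antisym (next-a i (suc (a i)) ≤-refl ai+1∉b) (a-inc i)

  jump : ∀ i j → 1 ≤ j → b j ≡ suc (a i) → (∀ k → b k ≢ suc (suc (a i))) →
         a (suc i) ≡ suc (suc (a i))
  jump i j 1≤j bj≡ ai+2∉b = ≤-antisym (next-a i (suc (suc (a i))) (s≤s (n≤1+n (a i))) ai+2∉b)
    (≤∧≢⇒< (a-inc i) λ ai+1≡ → disjoint (suc i) j (s≤s z≤n) 1≤j (trans (sym ai+1≡) (sym bj≡)))

  -- One step of a: either a stays in the current gap of b, or it jumps over
  -- the b-value a i + 1 = b (p+1) into the next gap.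
  step : ∀ {i p} → Inv i p →
    (a (suc i) ≡ suc (a i) × Inv (suc i) p) ⊎ (a (suc i) ≡ suc (suc (a i)) × Inv (suc i) (suc p))
  step {i} {p} I with m≤n⇒m<n∨m≡n (Inv.below I)
  ... | inj₁ i+p+1<b = inj₁ (ai+1≡ , inv-at refl (trans ai+1≡ ai+1≡i+p+1) (λ _ → s≤s (inv-lo I)) i+p+1<b)
    where
    ai+1≡i+p+1 : suc (a i) ≡ suc (i + p)
    ai+1≡i+p+1 = cong suc (Inv.val I)
    ai+1≡ : a (suc i) ≡ suc (a i)
    ai+1≡ = stay i λ j bj≡ → gap b-inc (s≤s (inv-lo I)) i+p+1<b j (trans bj≡ ai+1≡i+p+1)
  ... | inj₂ i+p+1≡b = inj₂ (ai+1≡ , inv-at (cong suc (sym (+-suc i p))) (trans ai+1≡ ai+2≡i+p+2)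
                                       (λ _ → b<i+p+2) i+p+2<b)
    where
    ai+2≡i+p+2 : suc (suc (a i)) ≡ suc (suc (i + p))
    ai+2≡i+p+2 = cong (suc ∘ suc) (Inv.val I)
    b<i+p+2 : b (suc p) < suc (suc (i + p))
    b<i+p+2 = subst (λ x → x < suc (suc (i + p))) i+p+1≡b ≤-refl
    i+p+2<b : suc (suc (i + p)) < b (suc (suc p))
    i+p+2<b = subst (λ x → 2 + x ≤ b (suc (suc p))) (sym i+p+1≡b) (b-step2 (suc p))
    ai+1≡ : a (suc i) ≡ suc (suc (a i))
    ai+1≡ = jump i (suc p) (s≤s z≤n) (trans (sym i+p+1≡b) (sym (cong suc (Inv.val I))))
              λ k bk≡ → gap b-inc b<i+p+2 i+p+2<b k (trans bk≡ ai+2≡i+p+2)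

  invariant : ∀ i → ∃[ p ] Inv i p
  invariant zero = 0 , inv-start
  invariant (suc i) with invariant i
  ... | p , I with step I
  ...   | inj₁ (_ , J) = p , J
  ...   | inj₂ (_ , J) = suc p , J

  a-step : ∀ n → a (suc n) ≡ suc (a n) ⊎ a (suc n) ≡ suc (suc (a n))
  a-step n with step (proj₂ (invariant n))
  ... | inj₁ (e , _) = inj₁ e
  ... | inj₂ (e , _) = inj₂ e

  a-step-le : ∀ n → a (suc n) ≤ 2 + a n
  a-step-le n with a-step n
  ... | inj₁ e = ≤-trans (≤-reflexive e) (n≤1+n _)
  ... | inj₂ e = ≤-reflexive e

  -- Part (iii): b outruns a, since b gains at least 2 per step and a at most 2.
  a<b : ∀ n → 1 ≤ n → a n < b n
  a<b (suc zero) _ = subst (_< b 1) (sym a1) b1≥2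
  a<b (suc (suc n)) _ = begin-strict
    a (suc (suc n))   ≤⟨ a-step-le (suc n) ⟩
    2 + a (suc n)     <⟨ +-monoʳ-< 2 (a<b (suc n) (s≤s z≤n)) ⟩
    2 + b (suc n)     ≤⟨ b-step2 (suc n) ⟩
    b (suc (suc n))   ∎
    where open ≤-Reasoning

  -- (2 + b n) ∸ (2 + a n) is definitionally b n ∸ a n.
  b∸a-mono : ∀ n → b n ∸ a n ≤ b (suc n) ∸ a (suc n)
  b∸a-mono n = ∸-mono (b-step2 n) (a-step-le n)

  -- Upper index bound: if r ≥ p + q + 2 then superadditivity pushes b r up
  -- to (m + n) + r, contradicting that a (m+n) = (m + n) + r lies above b r.
  index-upper : ∀ {m n p q r} → Inv m p → Inv n q → Inv (m + n) r → r ≤ suc (p + q)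
  index-upper {m} {n} {p} {q} {r} Im In Ir = ≮⇒≥ λ p+q+1<r →
    <⇒≱ (Inv.above Ir (≤-trans (s≤s z≤n) p+q+1<r)) (lift b-inc at-p+q+2 p+q+1<r)
    where
    at-p+q+2 : m + n + suc (suc (p + q)) ≤ b (suc (suc (p + q)))
    at-p+q+2 = begin
      m + n + suc (suc (p + q))       ≡⟨ regroup-suc m n p q ⟩
      suc (m + p) + suc (n + q)       ≤⟨ +-mono-≤ (Inv.below Im) (Inv.below In) ⟩
      b (suc p) + b (suc q)           ≤⟨ b-super p q ⟩
      b (suc (suc (p + q)))           ∎
      where open ≤-Reasoning

  -- Lower index bound, for the case that the second gap number is positive:
  -- if p + q ≥ r + 2 then b (p + q - 1) would have to be both below and
  -- at least (m + n) + (p + q - 1).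
  index-lower-core : ∀ {m n p q r} → b p ≤ m + p → b (suc q) < n + suc q →
                     m + n + r < b (suc r) → p + suc q ≤ suc r
  index-lower-core {m} {n} {p} {q} {r} bp≤ bq+1< m+n+r< = ≮⇒≥ λ r+1<p+q+1 →
    <⇒≱ b-below (lift b-inc at-r+1 (≤-pred (subst (suc (suc r) ≤_) (+-suc p q) r+1<p+q+1)))
    where
    at-r+1 : m + n + suc r ≤ b (suc r)
    at-r+1 = subst (_≤ b (suc r)) (sym (+-suc (m + n) r)) m+n+r<
    b-below : b (p + q) < m + n + (p + q)
    b-below = begin-strict
      b (p + q)               <⟨ b-sub p q ⟩
      b p + b (suc q)         ≤⟨ +-mono-≤ bp≤ (≤-pred (subst (suc (b (suc q)) ≤_) (+-suc n q) bq+1<)) ⟩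
      m + p + (n + q)         ≡⟨ interchange m p n q ⟩
      m + n + (p + q)         ∎
      where open ≤-Reasoning

  index-lower : ∀ {m n p q r} → Inv m p → Inv n q → Inv (m + n) r → p + q ≤ suc r
  index-lower {q = suc _} Im In Ir = index-lower-core (inv-lo Im) (Inv.above In (s≤s z≤n)) (Inv.below Ir)
  index-lower {p = zero} {q = zero} _ _ _ = z≤n
  index-lower {m} {n} {suc p} {zero} {r} Im In Ir =
    subst (_≤ suc r) (sym (+-identityʳ (suc p)))
      (index-lower-core (inv-lo In) (Inv.above Im (s≤s z≤n))
        (subst (λ x → x + r < b (suc r)) (+-comm m n) (Inv.below Ir)))

  a-almost-additive : ∀ m n → (a m + a n ≤ a (m + n) + 1) × (a (m + n) ≤ a m + a n + 1)
  a-almost-additive m n with invariant m | invariant n | invariant (m + n)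
  ... | p , Im | q , In | r , Ir = lower , upper
    where
    open ≤-Reasoning
    am+an : a m + a n ≡ m + n + (p + q)
    am+an = trans (cong₂ _+_ (Inv.val Im) (Inv.val In)) (interchange m p n q)
    lower : a m + a n ≤ a (m + n) + 1
    lower = begin
      a m + a n           ≡⟨ am+an ⟩
      m + n + (p + q)     ≤⟨ +-monoʳ-≤ (m + n) (index-lower Im In Ir) ⟩
      m + n + suc r       ≡⟨ +-suc (m + n) r ⟩
      suc (m + n + r)     ≡⟨ +-comm 1 (m + n + r) ⟩
      m + n + r + 1       ≡⟨ cong (_+ 1) (sym (Inv.val Ir)) ⟩
      a (m + n) + 1       ∎
    upper : a (m + n) ≤ a m + a n + 1
    upper = begin
      a (m + n)               ≡⟨ Inv.val Ir ⟩
      m + n + r               ≤⟨ +-monoʳ-≤ (m + n) (index-upper Im In Ir) ⟩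
      m + n + suc (p + q)     ≡⟨ +-suc (m + n) (p + q) ⟩
      suc (m + n + (p + q))   ≡⟨ +-comm 1 _ ⟩
      m + n + (p + q) + 1     ≡⟨ cong (_+ 1) (sym am+an) ⟩
      a m + a n + 1           ∎

proposition2p1 : (a b : ℕ → ℕ) →
    (∀ n → 1 ≤ n → 1 ≤ a n) → (∀ n → 1 ≤ n → 1 ≤ b n) →
    a 0 ≡ 0 → b 0 ≡ 0 →
    SAC (b 1) a b →
    ((∀ n → b n + b 1 ≤ b (suc n)) × 2 ≤ b 1)
    × (∀ n → (a (suc n) ≡ a n + 1) ⊎ (a (suc n) ≡ a n + 2))
    × ((∀ n → 1 ≤ n → a n < b n) × (∀ n → b n ∸ a n ≤ b (suc n) ∸ a (suc n)))
    × (∀ m n → (a m + a n ≤ a (m + n) + 1) × (a (m + n) ≤ a m + a n + 1))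
proposition2p1 a b _ b-pos a0 b0 sac =
  (b-step , b1≥2) , a-step′ , (a<b , b∸a-mono) , a-almost-additive
  where
  open SACPair a b a0 b0 (b-pos 1 (s≤s z≤n)) sac
  a-step′ : ∀ n → (a (suc n) ≡ a n + 1) ⊎ (a (suc n) ≡ a n + 2)
  a-step′ n with a-step n
  ... | inj₁ e = inj₁ (trans e (+-comm 1 (a n)))
  ... | inj₂ e = inj₂ (trans e (+-comm 2 (a n)))
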